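{- Let $E=[E,\leq,\varepsilon]$ be a nonempty heap in $H(P,\mathcal{C})$, let $\alpha$ be a minimal element of $E$, and let $F$ be the subheap of $E$ with underlying set $E\setminus\{\alpha\}$. Suppose that $F$ is ranked, that every minimal balanced subinterval of $E$ is ranked, and that the concurrency subgraph of $E$ contains no circuits. If $\beta,\gamma\in F$ lie in the same connected component of $F$ and $\alpha<\beta$ and $\alpha<\gamma$ are covering relations in $E$, then $\rho(\beta)=\rho(\gamma)$ for every rank function $\rho$ of $F$.
   Context: $P$ is a set with a symmetric reflexive relation $\mathcal{C}$. A labelled heap with pieces in $P$ is a triple $(E,\leq,\varepsilon)$ with $(E,\leq)$ a finite poset and $\varepsilon:E\to P$ such that: (1) if $\varepsilon(\alpha)\,\mathcal{C}\,\varepsilon(\beta)$ then $\alpha,\beta$ are comparable; (2) $\leq$ is the transitive closure of the relation: $\alpha\leq\beta$ and $\varepsilon(\alpha)\,\mathcal{C}\,\varepsilon(\beta)$. A heap is a labelled heap up to label-preserving poset isomorphism; $H(P,\mathcal{C})$ is the set of heaps. For $F\subseteq E$, the subheap on $F$ is $(F,\leq',\varepsilon|_F)$ where $\leq'$ is the transitive closure of the relation on $F$: $x\leq y$ and $\varepsilon(x)\,\mathcal{C}\,\varepsilon(y)$. The concurrency subgraph of $E$ is the simple graph on $\{\varepsilon(x):x\in E\}$ with an edge between $v\neq w$ iff $v\,\mathcal{C}\,w$; a circuit is a cycle. $a<b$ is a covering relation if no $c$ satisfies $a<c<b$. A rank function is $\rho$ into $\mathbb{Z}$ with $\rho(b)=\rho(a)+1$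 for each covering relation $a<b$; ranked means one exists. Connected components of a poset are the classes of the equivalence relation generated by covering relations. For $a\leq b$, $[a,b]=\{x:a\leq x\leq b\}$ with induced order; it is a minimal balanced subinterval if $a\neq b$, $\varepsilon(a)=\varepsilon(b)$, and no $c\in[a,b]$ other than $a,b$ has label $\varepsilon(a)$. -}

module Defs where

open import Data.Nat using (ℕ; suc)
open import Data.Fin using (Fin; zero; suc; inject₁; fromℕ)
open import Data.Integer using (ℤ; _+_; 1ℤ)
open import Data.Product using (Σ; ∃; _×_; _,_; proj₁)
open import Data.Sum using (_⊎_)
open import Relation.Nullary using (¬_)
open import Relation.Binary.PropositionalEquality using (_≡_; _≢_)
open import Relation.Binary.Structures using (IsPartialOrder)
open import Relation.Binary.Construct.Closure.Transitive using (TransClosure)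
open import Relation.Binary.Construct.Closure.Equivalence using (EqClosure)
open import Function.Definitions using (Injective)

-- Generic order notions on a carrier X with an order _≤_ and an
-- equality _≈_ of points (for subsets: equality of underlying points).

module Order {X : Set} (_≈_ : X → X → Set) (_≤_ : X → X → Set) where

  _<_ : X → X → Set
  a < b = a ≤ b × ¬ (a ≈ b)

  Covers : X → X → Set
  Covers a b = a < b × ¬ (Σ X λ c → a < c × c < b)

  IsRankFunction : (X → ℤ) → Set
  IsRankFunction ρ = ∀ a b → Covers a b → ρ b ≡ ρ a + 1ℤ

  Ranked : Set
  Ranked = Σ (X → ℤ) IsRankFunction

  SameComponent : X → X → Set
  SameComponent = EqClosure Covers

record Heap (P : Set) (C : P → P → Set) : Set₁ where
  field
    n          : ℕ
    _≤_        : Fin n → Fin n → Set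
    isPartialOrder : IsPartialOrder _≡_ _≤_
    ε          : Fin n → P
    comparable : ∀ a b → C (ε a) (ε b) → (a ≤ b) ⊎ (b ≤ a)
    -- (2) ≤ is the transitive closure of  (x ≤ y and ε x C ε y)
    --     (the reverse inclusion follows from transitivity of ≤)
    generated  : ∀ a b → a ≤ b →
                 TransClosure (λ x y → (x ≤ y) × C (ε x) (ε y)) a b

module HeapNotions {P : Set} {C : P → P → Set} (E : Heap P C) where
  open Heap E public

  open Order {Fin n} _≡_ _≤_ public

  IsMinimal : Fin n → Set
  IsMinimal a = ∀ x → x ≤ a → x ≡ a

  Without : Fin n → Set
  Without α = Σ (Fin n) λ x → x ≢ α

  module Sub (α : Fin n) where
    _≤F_ : Without α → Without α → Set
    _≤F_ = TransClosure {A = Without α}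
             (λ u v → (proj₁ u ≤ proj₁ v) × C (ε (proj₁ u)) (ε (proj₁ v)))
    _≈F_ : Without α → Without α → Set
    x ≈F y = proj₁ x ≡ proj₁ y
    open Order {Without α} _≈F_ _≤F_ public

  Interval : Fin n → Fin n → Set
  Interval a b = Σ (Fin n) λ x → (a ≤ x) × (x ≤ b)

  module Int (a b : Fin n) where
    _≤I_ : Interval a b → Interval a b → Set
    x ≤I y = proj₁ x ≤ proj₁ y
    _≈I_ : Interval a b → Interval a b → Set
    x ≈I y = proj₁ x ≡ proj₁ y
    open Order {Interval a b} _≈I_ _≤I_ public

  IntervalRanked : Fin n → Fin n → Set
  IntervalRanked a b = Int.Ranked a b

  MinimalBalanced : Fin n → Fin n → Set
  MinimalBalanced a b =
    (a ≤ b) × (a ≢ b) × (ε a ≡ ε b) ×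
    (∀ c → a ≤ c → c ≤ b → ε c ≡ ε a → (c ≡ a) ⊎ (c ≡ b))

  -- a circuit in the concurrency subgraph: distinct labels
  -- v₀, …, v_{k+2} (at least 3) occurring in E, consecutive ones
  -- (cyclically) related by C (distinct, hence edges of the simple graph)
  record Circuit : Set where
    field
      k        : ℕ
      v        : Fin (suc (suc (suc k))) → P
      distinct : Injective _≡_ _≡_ v
      occurs   : ∀ i → Σ (Fin n) λ x → ε x ≡ v i
      step     : ∀ (i : Fin (suc (suc k))) → C (v (inject₁ i)) (v (suc i))
      close    : C (v (fromℕ (suc (suc k)))) (v zero)

  NoCircuit : Set
  NoCircuit = ¬ Circuit

module Submission where

-- Let a = ε α. If some element x of F carries the label a, take a minimal
-- one: [α, x] is a minimal balanced interval, hence has a rank function ρI,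
-- and ρ − ρI is constant on the comparable pairs of (α, x] (it is so along
-- covering relations). Both β and γ cover α and lie below x, so ρI, and
-- therefore ρ, takes the same value on them. If no element of F carries the
-- label a, a path from β to γ in F gives a walk of consecutively adjacent
-- labels, all different from a; its ends ε β ≠ ε γ are adjacent to a, so
-- after erasing loops it closes a circuit through a. The case distinctions are
-- classical, which is harmless as the conclusion is a decidable equation in ℤ.

open import Defs
open import Data.Fin using (Fin)
open import Data.Integer using (ℤ)
open import Data.Product using (proj₁)
open import Relation.Binary.PropositionalEquality using (_≡_)
open import Relation.Binary.Definitions using (Reflexive; Symmetric)

open import Algebra.Bundles using (AbelianGroup)
open import Algebra.Properties.Group using (∙-cancelʳ)
open import Data.Empty using (⊥-elim)
open import Data.Fin using (zero; suc; inject₁; fromℕ)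
open import Data.Fin.Induction using (po-wellFounded; po-noetherian)
import Data.Fin.Properties as Finₚ
open import Data.Integer using (_+_; _-_; -_; 1ℤ)
import Data.Integer.Properties as ℤₚ
open import Data.Integer.Tactic.RingSolver using (solve-∀)
open import Data.List using (List; []; _∷_; length; lookup)
open import Data.List.Membership.Propositional using (_∈_)
open import Data.List.Membership.Propositional.Properties using (∈-lookup)
open import Data.List.Relation.Unary.All as All using (All; []; _∷_)
open import Data.List.Relation.Unary.All.Properties using (¬Any⇒All¬)
open import Data.List.Relation.Unary.AllPairs as AllPairs using ([]; _∷_)
open import Data.List.Relation.Unary.Any using (here; there)
open import Data.List.Relation.Unary.Linked as Linked using (Linked; [-]; _∷_)
open import Data.List.Relation.Unary.Unique.Propositional using (Unique)
open import Data.Product using (Σ-syntax; _×_; _,_; proj₂)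
open import Data.Sum using (_⊎_; inj₁; inj₂)
open import Function using (_∘_; id; flip; case_of_)
open import Function.Definitions using (Injective)
open import Induction.WellFounded using (WellFounded; Acc; acc)
open import Level using (Level)
open import Relation.Binary.Core using (Rel; _⇒_)
open import Relation.Binary.Construct.Closure.ReflexiveTransitive
  using (Star; _◅_; gmap) renaming (ε to nil)
open import Relation.Binary.Construct.Closure.Symmetric using (SymClosure; fwd; bwd)
open import Relation.Binary.Construct.Closure.Transitive using (TransClosure; [_]; _∷_)
open import Relation.Binary.Definitions using (Transitive)
open import Relation.Binary.PropositionalEquality
  using (_≢_; refl; sym; trans; cong; cong₂; subst; module ≡-Reasoning)
open import Relation.Binary.Structures using (IsPartialOrder)
open import Relation.Nullary using (¬_; Dec; yes; no)
open import Relation.Nullary.Decidable using (decidable-stable; ¬¬-excluded-middle)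

private
  variable
    a ℓ : Level
    A : Set a

by-excluded-middle : ∀ {G Q : Set} → Dec G → (Q → G) → (¬ Q → G) → G
by-excluded-middle G? on-yes on-no =
  decidable-stable G? λ ¬g → ¬¬-excluded-middle λ where
    (yes q) → ¬g (on-yes q)
    (no ¬q) → ¬g (on-no ¬q)

+-cancelʳ-≡ : ∀ k {i j} → i + k ≡ j + k → i ≡ j
+-cancelʳ-≡ k = ∙-cancelʳ (AbelianGroup.group ℤₚ.+-0-abelianGroup) k _ _

[i+1]-[j+1]≡i-j : ∀ i j → (i + 1ℤ) - (j + 1ℤ) ≡ i - j
[i+1]-[j+1]≡i-j = solve-∀

TransClosure⇒ : ∀ {ℓ′} {R : Rel A ℓ} {S : Rel A ℓ′} → R ⇒ S → Transitive S → TransClosure R ⇒ S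
TransClosure⇒ R⇒S S-trans [ r ] = R⇒S r
TransClosure⇒ R⇒S S-trans (r ∷ rs) = S-trans (R⇒S r) (TransClosure⇒ R⇒S S-trans rs)

Linked-lookup : ∀ {R : Rel A ℓ} {x y xs} → Linked R (x ∷ y ∷ xs) →
                ∀ i → R (lookup (x ∷ y ∷ xs) (inject₁ i)) (lookup (x ∷ y ∷ xs) (suc i))
Linked-lookup (r ∷ _) zero = r
Linked-lookup {xs = []} _ (suc ())
Linked-lookup {xs = _ ∷ _} (_ ∷ rs) (suc i) = Linked-lookup rs i

Unique⇒lookup-injective : ∀ {xs : List A} → Unique xs → Injective _≡_ _≡_ (lookup xs)
Unique⇒lookup-injective (_ ∷ _) {zero} {zero} _ = refl
Unique⇒lookup-injective (x∉ ∷ _) {zero} {suc j} eq = ⊥-elim (All.lookup x∉ (∈-lookup j) eq)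
Unique⇒lookup-injective (x∉ ∷ _) {suc i} {zero} eq = ⊥-elim (All.lookup x∉ (∈-lookup i) (sym eq))
Unique⇒lookup-injective (_ ∷ xs-unique) {suc i} {suc j} eq =
  cong suc (Unique⇒lookup-injective xs-unique eq)

module _ {R : Rel A ℓ} where

  targets : ∀ {x y} → Star R x y → List A
  targets nil = []
  targets (_◅_ {j = z} _ p) = z ∷ targets p

  lookup-targets-last : ∀ {x y} (p : Star R x y) →
                        lookup (x ∷ targets p) (fromℕ (length (targets p))) ≡ y
  lookup-targets-last nil = refl
  lookup-targets-last (_ ◅ p) = lookup-targets-last p

  targets-Linked : ∀ {x y} (p : Star R x y) → Linked R (x ∷ targets p)
  targets-Linked nil = [-]
  targets-Linked (r ◅ p) = r ∷ targets-Linked p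

  targets-All : ∀ {Q : A → Set ℓ} → (∀ {x y} → R x y → Q y) →
                ∀ {x y} (p : Star R x y) → All Q (targets p)
  targets-All Q-target nil = []
  targets-All Q-target (r ◅ p) = Q-target r ∷ targets-All Q-target p

  suffix-from : ∀ {x u y} (p : Star R u y) → x ∈ u ∷ targets p →
                Σ[ q ∈ Star R x y ] (Unique (u ∷ targets p) → Unique (x ∷ targets q))
  suffix-from p (here refl) = p , id
  suffix-from (_ ◅ p) (there x∈p) =
    let q , simple = suffix-from p x∈p in q , simple ∘ AllPairs.tail

  -- Equality of vertices need not be decidable, hence the double negation.
  loop-erase : ∀ {x y} (p : Star R x y) → ¬ ¬ (Σ[ q ∈ Star R x y ] Unique (x ∷ targets q))
  loop-erase nil ¬simple = ¬simple (nil , [] ∷ [])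
  loop-erase {x} {y} (_◅_ {j = z} r p) ¬simple =
    loop-erase p λ (q , simple) →
    ¬¬-excluded-middle λ x∈q? → ¬simple (extend q simple x∈q?)
    where
    extend : (q : Star R z y) → Unique (z ∷ targets q) → Dec (x ∈ z ∷ targets q) →
             Σ[ q′ ∈ Star R x y ] Unique (x ∷ targets q′)
    extend q simple (yes x∈q) = let q′ , simple′ = suffix-from q x∈q in q′ , simple′ simple
    extend q simple (no x∉q) = r ◅ q , ¬Any⇒All¬ _ x∉q ∷ simple

module HeapProperties {P : Set} {C : Rel P _} (C-refl : Reflexive C) (C-sym : Symmetric C)
                      (E : Heap P C) where
  open HeapNotions E
  module ≤ = IsPartialOrder isPartialOrder

  <-wellFounded : WellFounded _<_
  <-wellFounded = po-wellFounded isPartialOrder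

  >-wellFounded : WellFounded (flip _<_)
  >-wellFounded = po-noetherian isPartialOrder

  covers-between : ∀ {u v w} → Covers u v → u ≤ w → w ≤ v → w ≡ u ⊎ w ≡ v
  covers-between {u} {v} {w} (_ , ∄between) u≤w w≤v with w Finₚ.≟ u | w Finₚ.≟ v
  ... | yes w≡u | _ = inj₁ w≡u
  ... | no _ | yes w≡v = inj₂ w≡v
  ... | no w≢u | no w≢v = ⊥-elim (∄between (w , (u≤w , w≢u ∘ sym) , (w≤v , w≢v)))

  covers-adjacent : ∀ {u v} → Covers u v → C (ε u) (ε v)
  covers-adjacent {u} {v} u⋖v = adjacent-chain (generated u v (proj₁ (proj₁ u⋖v)))
    where
    adjacent-chain : TransClosure (λ x y → x ≤ y × C (ε x) (ε y)) u v → C (ε u) (ε v)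
    adjacent-chain [ _ , u~v ] = u~v
    adjacent-chain (_∷_ {y = w} (u≤w , u~w) w≤⁺v)
      with covers-between u⋖v u≤w (TransClosure⇒ proj₁ ≤.trans w≤⁺v)
    ... | inj₁ refl = adjacent-chain w≤⁺v
    ... | inj₂ refl = u~w

  same-label-comparable : ∀ {u v} → ε u ≡ ε v → u ≤ v ⊎ v ≤ u
  same-label-comparable {u} {v} εu≡εv = comparable u v (subst (C (ε u)) εu≡εv C-refl)

  strictly-above-≤-cover⇒≡ : ∀ {α u w} → Covers α u → α < w → w ≤ u → w ≡ u
  strictly-above-≤-cover⇒≡ α⋖u (α≤w , α≢w) w≤u with covers-between α⋖u α≤w w≤u
  ... | inj₁ w≡α = ⊥-elim (α≢w (sym w≡α))
  ... | inj₂ w≡u = w≡u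

  upper-covers-same-label : ∀ {α u v} → Covers α u → Covers α v → ε u ≡ ε v → u ≡ v
  upper-covers-same-label α⋖u α⋖v εu≡εv with same-label-comparable εu≡εv
  ... | inj₁ u≤v = strictly-above-≤-cover⇒≡ α⋖v (proj₁ α⋖u) u≤v
  ... | inj₂ v≤u = sym (strictly-above-≤-cover⇒≡ α⋖u (proj₁ α⋖v) v≤u)

  Occurs : P → Set
  Occurs p = Σ[ x ∈ Fin n ] ε x ≡ p

  closed-walk-circuit : ∀ {R : Rel P ℓ} → R ⇒ C → ∀ {a x y} (p : Star R x y) → x ≢ y →
                        C a x → C y a → Unique (a ∷ x ∷ targets p) →
                        All Occurs (a ∷ x ∷ targets p) → Circuit
  closed-walk-circuit R⇒C nil x≢x _ _ _ _ = ⊥-elim (x≢x refl)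
  closed-walk-circuit R⇒C {a} {x} (_◅_ {j = z} r p) _ a~x y~a simple occurring = record
    { k        = length (targets p)
    ; v        = lookup cycle
    ; distinct = Unique⇒lookup-injective simple
    ; occurs   = λ i → All.lookup occurring (∈-lookup i)
    ; step     = Linked-lookup (a~x ∷ Linked.map R⇒C (targets-Linked (r ◅ p)))
    ; close    = subst (λ y → C y a) (sym (lookup-targets-last p)) y~a
    }
    where
    cycle : List P
    cycle = a ∷ x ∷ z ∷ targets p

  module Subheap {α} (α-min : IsMinimal α) where
    module F = Sub α

    ≢α-upward : ∀ {y w} → y ≢ α → y ≤ w → w ≢ α
    ≢α-upward y≢α y≤α refl = y≢α (α-min _ y≤α)

    sub≤⇒≤ : ∀ {u v} → u F.≤F v → proj₁ u ≤ proj₁ v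
    sub≤⇒≤ = TransClosure⇒ proj₁ ≤.trans

    ≤⇒sub≤ : ∀ {u v} → proj₁ u ≤ proj₁ v → u F.≤F v
    ≤⇒sub≤ {y , y≢α} {x , x≢α} y≤x = lift y≢α (generated y x y≤x)
      where
      lift : ∀ {w} (w≢α : w ≢ α) → TransClosure (λ s t → s ≤ t × C (ε s) (ε t)) w x →
             (w , w≢α) F.≤F (x , x≢α)
      lift w≢α [ r ] = [ r ]
      lift w≢α (r ∷ rs) = r ∷ lift (≢α-upward w≢α (proj₁ r)) rs

    subCovers⇒covers : ∀ {u v} → F.Covers u v → Covers (proj₁ u) (proj₁ v)
    subCovers⇒covers {u} ((u≤v , u≢v) , ∄between) =
      (sub≤⇒≤ u≤v , u≢v) , λ (c , (u≤c , u≢c) , (c≤v , c≢v)) →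
        ∄between ((c , ≢α-upward (proj₂ u) u≤c) , (≤⇒sub≤ u≤c , u≢c) , (≤⇒sub≤ c≤v , c≢v))

    covers⇒subCovers : ∀ {u v} → Covers (proj₁ u) (proj₁ v) → F.Covers u v
    covers⇒subCovers ((u≤v , u≢v) , ∄between) =
      (≤⇒sub≤ u≤v , u≢v) , λ (c , (u≤c , u≢c) , (c≤v , c≢v)) →
        ∄between (proj₁ c , (sub≤⇒≤ u≤c , u≢c) , (sub≤⇒≤ c≤v , c≢v))

    same-label-above : ∀ {x} → x ≢ α → ε x ≡ ε α → α ≤ x
    same-label-above {x} x≢α εx≡εα with same-label-comparable (sym εx≡εα)
    ... | inj₁ α≤x = α≤x
    ... | inj₂ x≤α = ⊥-elim (x≢α (α-min x x≤α))

    minimal-balanced : ∀ {x} → x ≢ α → ε x ≡ ε α →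
                       ¬ (Σ[ c ∈ Fin n ] c ≢ α × c < x × ε c ≡ ε α) → MinimalBalanced α x
    minimal-balanced {x} x≢α εx≡εα ∄c =
      same-label-above x≢α εx≡εα , x≢α ∘ sym , sym εx≡εα , only-ends
      where
      only-ends : ∀ c → α ≤ c → c ≤ x → ε c ≡ ε α → c ≡ α ⊎ c ≡ x
      only-ends c _ c≤x εc≡εα with c Finₚ.≟ α | c Finₚ.≟ x
      ... | yes c≡α | _ = inj₁ c≡α
      ... | no _ | yes c≡x = inj₂ c≡x
      ... | no c≢α | no c≢x = ⊥-elim (∄c (c , c≢α , (c≤x , c≢x) , εc≡εα))

    FLabel : P → Set
    FLabel p = Σ[ u ∈ Without α ] ε (proj₁ u) ≡ p

    LabelStep : Rel P _
    LabelStep p q = C p q × FLabel q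

    label-walk : ∀ {u v} → F.SameComponent u v → Star LabelStep (ε (proj₁ u)) (ε (proj₁ v))
    label-walk = gmap (ε ∘ proj₁) λ {_} {v} s → adjacent s , v , refl
      where
      adjacent : ∀ {u v} → SymClosure F.Covers u v → C (ε (proj₁ u)) (ε (proj₁ v))
      adjacent (fwd u⋖v) = covers-adjacent (subCovers⇒covers u⋖v)
      adjacent (bwd v⋖u) = C-sym (covers-adjacent (subCovers⇒covers v⋖u))

    component-closes-circuit : ¬ FLabel (ε α) → ∀ {β γ} → F.SameComponent β γ →
                               Covers α (proj₁ β) → Covers α (proj₁ γ) → proj₁ β ≢ proj₁ γ →
                               ¬ ¬ Circuit
    component-closes-circuit α-unlabelled {β} β~γ α⋖β α⋖γ β≢γ no-circuit =
      loop-erase (label-walk β~γ) λ (q , simple) →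
        let labels = (β , refl) ∷ targets-All proj₂ q in
        no-circuit (closed-walk-circuit proj₁ q (β≢γ ∘ upper-covers-same-label α⋖β α⋖γ)
          (covers-adjacent α⋖β) (C-sym (covers-adjacent α⋖γ))
          (All.map (λ (u , εu≡p) εα≡p → α-unlabelled (u , trans εu≡p (sym εα≡p))) labels
             ∷ simple)
          ((α , refl) ∷ All.map (λ (u , εu≡p) → proj₁ u , εu≡p) labels))

    module _ (ρ : Without α → ℤ) (ρ-rank : F.IsRankFunction ρ) where

      -- ρ may depend on the proof that a point differs from α; the first step
      -- of the component path pins its value down independently of that proof.
      same-point-same-rank : ∀ {u v} → proj₁ u ≡ proj₁ v → F.SameComponent u v → ρ u ≡ ρ v
      same-point-same-rank _ nil = refl
      same-point-same-rank {u} {v} u≡v (_◅_ {j = w} (fwd u⋖w) _) =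
        +-cancelʳ-≡ 1ℤ (trans (sym (ρ-rank u w u⋖w)) (ρ-rank v w v⋖w))
        where
        v⋖w : F.Covers v w
        v⋖w = covers⇒subCovers (subst (λ t → Covers t (proj₁ w)) u≡v (subCovers⇒covers u⋖w))
      same-point-same-rank {u} {v} u≡v (_◅_ {j = w} (bwd w⋖u) _) =
        trans (ρ-rank w u w⋖u) (sym (ρ-rank w v w⋖v))
        where
        w⋖v : F.Covers w v
        w⋖v = covers⇒subCovers (subst (Covers (proj₁ w)) u≡v (subCovers⇒covers w⋖u))

      module BalancedInterval {x} (x≢α : x ≢ α) (εx≡εα : ε x ≡ ε α) (α≤x : α ≤ x)
                              (ρI : Interval α x → ℤ) (ρI-rank : Int.IsRankFunction α x ρI) where

        HalfOpen : Set
        HalfOpen = Σ[ y ∈ Fin n ] y ≢ α × α ≤ y × y ≤ x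

        δ : HalfOpen → ℤ
        δ (y , y≢α , α≤y , y≤x) = ρ (y , y≢α) - ρI (y , α≤y , y≤x)

        ρI-covers : ∀ u v → Covers (proj₁ u) (proj₁ v) → ρI v ≡ ρI u + 1ℤ
        ρI-covers u v (u<v , ∄between) =
          ρI-rank u v (u<v , λ (c , u<c , c<v) → ∄between (proj₁ c , u<c , c<v))

        δ-covers : ∀ u v → Covers (proj₁ u) (proj₁ v) → δ u ≡ δ v
        δ-covers (y , y≢α , α≤y , y≤x) (z , z≢α , α≤z , z≤x) y⋖z = sym (trans
          (cong₂ _-_ (ρ-rank (y , y≢α) (z , z≢α) (covers⇒subCovers y⋖z))
                     (ρI-covers (y , α≤y , y≤x) (z , α≤z , z≤x) y⋖z))
          ([i+1]-[j+1]≡i-j (ρ (y , y≢α)) (ρI (y , α≤y , y≤x))))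

        -- Induction on y upwards and, for fixed y, on z downwards: an element
        -- strictly between y and z splits the claim into two smaller instances.
        δ-constant : ∀ u v → proj₁ u < proj₁ v → δ u ≡ δ v
        δ-constant u v = go u v (>-wellFounded _) (<-wellFounded _)
          where
          go : ∀ u v → Acc (flip _<_) (proj₁ u) → Acc _<_ (proj₁ v) → proj₁ u < proj₁ v → δ u ≡ δ v
          go u@(y , y≢α , α≤y , _) v@(_ , _ , _ , z≤x) acc-y@(acc above) (acc below) y<z =
            by-excluded-middle (δ u ℤₚ.≟ δ v)
              (λ (c , y<c , c<z) →
                let ĉ = c , ≢α-upward y≢α (proj₁ y<c) ,
                        ≤.trans α≤y (proj₁ y<c) , ≤.trans (proj₁ c<z) z≤x
                in trans (go u ĉ acc-y (below c<z) y<c) (go ĉ v (above y<c) (<-wellFounded _) c<z))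
              (λ ∄c → δ-covers u v (y<z , ∄c))

        upper-cover≤x : ∀ {u} → Covers α u → u ≤ x
        upper-cover≤x {u} α⋖u
          with comparable u x (subst (C (ε u)) (sym εx≡εα) (C-sym (covers-adjacent α⋖u)))
        ... | inj₁ u≤x = u≤x
        ... | inj₂ x≤u = ≤.reflexive (sym (strictly-above-≤-cover⇒≡ α⋖u (α≤x , x≢α ∘ sym) x≤u))

        upper-cover<x : ∀ {u v} → Covers α u → Covers α v → u ≢ v → u < x
        upper-cover<x {u} {v} α⋖u α⋖v u≢v = upper-cover≤x α⋖u , λ u≡x →
          u≢v (sym (strictly-above-≤-cover⇒≡ α⋖u (proj₁ α⋖v)
                      (subst (v ≤_) (sym u≡x) (upper-cover≤x α⋖v))))

        upper-covers-same-rank : ∀ {β γ} → Covers α (proj₁ β) → Covers α (proj₁ γ) →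
                                 proj₁ β ≢ proj₁ γ → ρ β ≡ ρ γ
        upper-covers-same-rank {β₀ , β≢α} {γ₀ , γ≢α} α⋖β α⋖γ β≢γ = +-cancelʳ-≡ (- ρI β̃) (begin
          δ β̂              ≡⟨ δ-constant β̂ x̂ (upper-cover<x α⋖β α⋖γ β≢γ) ⟩
          δ x̂              ≡⟨ δ-constant γ̂ x̂ (upper-cover<x α⋖γ α⋖β (β≢γ ∘ sym)) ⟨
          δ γ̂              ≡⟨ cong (λ r → ρ (γ₀ , γ≢α) - r) ρI-γ≡ρI-β ⟩
          ρ (γ₀ , γ≢α) - ρI β̃ ∎)
          where
          open ≡-Reasoning
          α̃ β̃ γ̃ : Interval α x
          α̃ = α , ≤.refl , α≤x
          β̃ = β₀ , proj₁ (proj₁ α⋖β) , upper-cover≤x α⋖β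
          γ̃ = γ₀ , proj₁ (proj₁ α⋖γ) , upper-cover≤x α⋖γ
          β̂ γ̂ x̂ : HalfOpen
          β̂ = β₀ , β≢α , proj₂ β̃
          γ̂ = γ₀ , γ≢α , proj₂ γ̃
          x̂ = x , x≢α , α≤x , ≤.refl
          ρI-γ≡ρI-β : ρI γ̃ ≡ ρI β̃
          ρI-γ≡ρI-β = trans (ρI-covers α̃ γ̃ α⋖γ) (sym (ρI-covers α̃ β̃ α⋖β))

      upper-covers-same-rank : (∀ a b → MinimalBalanced a b → IntervalRanked a b) →
                               FLabel (ε α) → ∀ {β γ} → Covers α (proj₁ β) → Covers α (proj₁ γ) →
                               proj₁ β ≢ proj₁ γ → ρ β ≡ ρ γ
      upper-covers-same-rank balanced-ranked ((x , x≢α) , εx≡εα) {β} {γ} α⋖β α⋖γ β≢γ =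
        go (<-wellFounded x) x≢α εx≡εα
        where
        go : ∀ {x} → Acc _<_ x → x ≢ α → ε x ≡ ε α → ρ β ≡ ρ γ
        go {x} (acc below) x≢α εx≡εα = by-excluded-middle (ρ β ℤₚ.≟ ρ γ)
          (λ (c , c≢α , c<x , εc≡εα) → go (below c<x) c≢α εc≡εα)
          (λ ∄c → let ρI , ρI-rank = balanced-ranked α x (minimal-balanced x≢α εx≡εα ∄c) in
            BalancedInterval.upper-covers-same-rank x≢α εx≡εα (same-label-above x≢α εx≡εα)
              ρI ρI-rank α⋖β α⋖γ β≢γ)

lemma2p2p1 : (P : Set) (C : P → P → Set) → Reflexive C → Symmetric C →
    (E : Heap P C) →
    let open HeapNotions E in
    (α : Fin n) → IsMinimal α →
    Sub.Ranked α →
    (∀ a b → MinimalBalanced a b → IntervalRanked a b) →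
    NoCircuit →
    (β γ : Without α) → Sub.SameComponent α β γ →
    Covers α (proj₁ β) → Covers α (proj₁ γ) →
    (ρ : Without α → ℤ) → Sub.IsRankFunction α ρ → ρ β ≡ ρ γ
lemma2p2p1 P C C-refl C-sym E α α-min _ balanced-ranked no-circuit β γ β~γ α⋖β α⋖γ ρ ρ-rank =
  case proj₁ β Finₚ.≟ proj₁ γ of λ where
    (yes β≡γ) → same-point-same-rank ρ ρ-rank β≡γ β~γ
    (no β≢γ) → by-excluded-middle (ρ β ℤₚ.≟ ρ γ)
      (λ α-relabelled → upper-covers-same-rank ρ ρ-rank balanced-ranked α-relabelled α⋖β α⋖γ β≢γ)
      (λ α-unlabelled → ⊥-elim (component-closes-circuit α-unlabelled β~γ α⋖β α⋖γ β≢γ no-circuit))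
  where
  open HeapProperties C-refl C-sym E
  open Subheap α-min
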